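{- For all $n\in\mathbb{N}$ (where $0\in\mathbb{N}$), we have $g_2(n)=2n$ if and only if one of the following holds: (1) $n>3$ is prime; (2) $n=0$; (3) $n=6$.
   Context: $\mathbb{N}=\{0,1,2,\dots\}$. For an integer $m\ge 2$, an $m$-product sequence is a finite sequence of integers $a_1\le a_2\le\dots\le a_t$ such that $\prod_{i=1}^t a_i=R^m$ for some $R\in\mathbb{N}$ and no integer appears more than $m-1$ times in the sequence. For $n\in\mathbb{N}$, $g_m(n)$ is the least integer $s$ such that there exists an $m$-product sequence $a_1\le\dots\le a_t$ with $a_1=n$ and $a_t=s$. (Thus $g_2(n)$ is the least $s\ge n$ such that $n$ times a product of distinct integers in $(n,s]$ is a perfect square.) -}

module Defs where

open import Data.Nat using (ℕ; _≤_; _∸_; _^_; _≟_)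
open import Data.List using (List; _∷_; last; filter; length)
open import Data.Nat.ListAction using (product)
open import Data.List.Relation.Unary.Linked using (Linked)
open import Data.Maybe using (Maybe; just)
open import Data.Product using (∃; _×_)
open import Relation.Binary.PropositionalEquality using (_≡_)

-- An m-product sequence a₁ ≤ … ≤ a_t (t ≥ 1), given as a nonempty list.
-- Entries are natural numbers: since a₁ = n ∈ ℕ and the sequence is
-- nondecreasing, every entry is ≥ n ≥ 0 anyway.
record IsProductSeq (m : ℕ) (as : List ℕ) : Set where
  field
    sorted       : Linked _≤_ as
    perfectPower : ∃ λ (R : ℕ) → product as ≡ R ^ m
    multiplicity : ∀ (x : ℕ) → length (filter (x ≟_) as) ≤ m ∸ 1

Reaches : ℕ → ℕ → ℕ → Set
Reaches m n s = ∃ λ (as : List ℕ) → IsProductSeq m (n ∷ as) × (last (n ∷ as) ≡ just s)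

IsG : ℕ → ℕ → ℕ → Set
IsG m n s = Reaches m n s × (∀ (s′ : ℕ) → Reaches m n s′ → s ≤ s′)

-- g₂(n) = s amounts to: s is least such that n times a product of distinct
-- integers in (n, s] is a square.  A prime p divides none of the integers in
-- (p, 2p), so g₂(p) ≥ 2p, and for p > 3 the sequence p < 2k² < 2p with
-- k² < p ≤ (k + 1)² attains it.  A square n = q² has g₂(n) = n, and any other
-- composite n = ab with 2 ≤ a < b has g₂(n) ≤ (a + 1)(b + 1) through
-- ab · a(b + 1) · (a + 1)b · (a + 1)(b + 1), which is below 2ab unless
-- (a, b) = (2, 3).  The cases n = 2, 3, 6 are settled by exhaustive search.
module Submission where

open import Defs
open import Data.Nat using (ℕ; _<_; _*_)
open import Data.Nat.Primality using (Prime)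
open import Data.Sum using (_⊎_)
open import Data.Product using (_×_)
open import Function.Bundles using (_⇔_)
open import Relation.Binary.PropositionalEquality using (_≡_)

open import Algebra.Definitions.RawMagma using (_,_)
open import Data.Bool using (Bool; true; false; T; T?)
open import Data.Empty using (⊥-elim)
open import Data.List using (List; []; _∷_; _++_; map; last; filter; length)
open import Data.List.Membership.Propositional using (_∈_)
open import Data.List.Membership.Propositional.Properties using (∈-++⁺ˡ; ∈-++⁺ʳ; ∈-map⁺)
open import Data.List.Properties using (filter-accept; filter-reject; filter-none)
open import Data.List.Relation.Unary.All as All using (All; []; _∷_)
open import Data.List.Relation.Unary.Any using (here)
open import Data.List.Relation.Unary.Linked as Linked using (Linked; []; [-]; _∷_)
open import Data.List.Relation.Unary.Linked.Properties using (Linked⇒All)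
open import Data.Maybe using (just)
open import Data.Nat
  using (suc; zero; _+_; _^_; _≤_; _≟_; _<?_; _≤?_; z≤n; s≤s; z<s; NonZero; nonTrivial⇒n>1)
open import Data.Nat.Divisibility using (_∣_; _∤_; divides; ∣1⇒≡1)
open import Data.Nat.ListAction using (product)
open import Data.Nat.Primality
  using (Composite; composite; euclidsLemma; prime?; prime⇒nonZero; ¬prime[1];
         ¬prime⇒composite; composite⇒nonZero)
open import Data.Nat.Properties
open import Data.Nat.Tactic.RingSolver using (solve-∀)
open import Data.Product using (∃; ∃₂; _,_; proj₁)
open import Data.Sum using (inj₁; inj₂)
open import Function using (_∘_)
open import Function.Bundles using (mk⇔)
open import Relation.Binary using (tri<; tri≈; tri>)
open import Relation.Binary.PropositionalEquality using (refl; sym; trans; cong; subst; _≢_)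
open import Relation.Nullary using (¬_; Dec; yes; no; contradiction)
open import Relation.Nullary.Decidable using (from-no; from-yes)

IsSquare : ℕ → Set
IsSquare c = ∃ λ R → c ≡ R ^ 2

count : ℕ → List ℕ → ℕ
count x xs = length (filter (x ≟_) xs)

count-∷-≡ : ∀ x xs → count x (x ∷ xs) ≡ suc (count x xs)
count-∷-≡ x xs = cong length (filter-accept (x ≟_) {xs = xs} refl)

count-∷-≢ : ∀ {x y} xs → x ≢ y → count x (y ∷ xs) ≡ count x xs
count-∷-≢ {x} xs x≢y = cong length (filter-reject (x ≟_) {xs = xs} x≢y)

count-∷ : ∀ x y xs → count x xs ≤ count x (y ∷ xs)
count-∷ x y xs with x ≟ y
... | yes refl = ≤-trans (n≤1+n _) (≤-reflexive (sym (count-∷-≡ x xs)))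
... | no x≢y = ≤-reflexive (sym (count-∷-≢ xs x≢y))

count-duplicate : ∀ {x y} xs → x ≡ y → count x (x ∷ y ∷ xs) ≡ 2 + count x xs
count-duplicate {x} xs refl = trans (count-∷-≡ x (x ∷ xs)) (cong suc (count-∷-≡ x xs))

count-absent : ∀ {x xs} → All (x ≢_) xs → count x xs ≡ 0
count-absent {x} x∉xs = cong length (filter-none (x ≟_) x∉xs)

head<all : ∀ {x xs} → Linked _<_ (x ∷ xs) → All (x <_) xs
head<all [-] = []
head<all (x<y ∷ ys) = Linked⇒All <-trans x<y ys

<-linked⇒count≤1 : ∀ {xs} → Linked _<_ xs → ∀ x → count x xs ≤ 1
<-linked⇒count≤1 [] x = z≤n
<-linked⇒count≤1 {y ∷ ys} y<ys x with x ≟ y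
... | yes refl =
  ≤-reflexive (trans (count-∷-≡ x ys) (cong suc (count-absent (All.map <⇒≢ (head<all y<ys)))))
... | no x≢y = ≤-trans (≤-reflexive (count-∷-≢ ys x≢y)) (<-linked⇒count≤1 (Linked.tail y<ys) x)

≤-linked∧count≤1⇒<-linked : ∀ {xs} → Linked _≤_ xs → (∀ x → count x xs ≤ 1) → Linked _<_ xs
≤-linked∧count≤1⇒<-linked [] _ = []
≤-linked∧count≤1⇒<-linked [-] _ = [-]
≤-linked∧count≤1⇒<-linked {x ∷ y ∷ xs} (x≤y ∷ y≤xs) count≤1 =
  ≤∧≢⇒< x≤y x≢y ∷ ≤-linked∧count≤1⇒<-linked y≤xs (λ z → ≤-trans (count-∷ z x (y ∷ xs)) (count≤1 z))
  where
  x≢y : x ≢ y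
  x≢y x≡y = <⇒≱ (subst (1 <_) (sym (count-duplicate xs x≡y)) (s≤s (s≤s z≤n))) (count≤1 x)

last-maximal : ∀ {x xs s} → Linked _≤_ (x ∷ xs) → last (x ∷ xs) ≡ just s → All (_≤ s) (x ∷ xs)
last-maximal {xs = []} _ refl = ≤-refl ∷ []
last-maximal {xs = y ∷ ys} (x≤y ∷ y≤ys) lastIs with last-maximal y≤ys lastIs
... | y≤s ∷ ys≤s = ≤-trans x≤y y≤s ∷ y≤s ∷ ys≤s

record SquareCompletion (n s : ℕ) : Set where
  field
    factors    : List ℕ
    increasing : Linked _<_ factors
    above      : All (n <_) factors
    atMost     : All (_≤ s) factors
    square     : IsSquare (n * product factors)

reaches⇒completion : ∀ {n s} → Reaches 2 n s → SquareCompletion n s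
reaches⇒completion {n} (as , seq , lastIs) = record
  { factors    = as
  ; increasing = Linked.tail n<as
  ; above      = head<all n<as
  ; atMost     = All.tail (last-maximal sorted lastIs)
  ; square     = perfectPower
  }
  where
  open IsProductSeq seq
  n<as : Linked _<_ (n ∷ as)
  n<as = ≤-linked∧count≤1⇒<-linked sorted multiplicity

increasing⇒reaches : ∀ {m n s as} → 2 ≤ m → Linked _<_ (n ∷ as) →
  (∃ λ R → product (n ∷ as) ≡ R ^ m) → last (n ∷ as) ≡ just s → Reaches m n s
increasing⇒reaches {as = as} 2≤m n<as power lastIs = as , seq , lastIs
  where
  seq : IsProductSeq _ _
  seq = record
    { sorted       = Linked.map <⇒≤ n<as
    ; perfectPower = power
    ; multiplicity = λ x → ≤-trans (<-linked⇒count≤1 n<as x) (∸-monoˡ-≤ 1 2≤m)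
    }

reaches-below⇒¬IsG : ∀ {m n s t} → Reaches m n s → s < t → ¬ IsG m n t
reaches-below⇒¬IsG r s<t (_ , minimal) = <⇒≱ s<t (minimal _ r)

prime∣square⇒prime∣root : ∀ {p R} → Prime p → p ∣ R ^ 2 → p ∣ R
prime∣square⇒prime∣root {R = R} pp p∣R² with euclidsLemma R (R * 1) pp p∣R²
... | inj₁ p∣R = p∣R
... | inj₂ p∣R*1 = subst (_ ∣_) (*-identityʳ R) p∣R*1

prime*m-square⇒prime∣m : ∀ {p m} → Prime p → IsSquare (p * m) → p ∣ m
prime*m-square⇒prime∣m {p} {m} pp (R , pm≡R²)
  with prime∣square⇒prime∣root {R = R} pp (divides m (trans (sym pm≡R²) (*-comm p m)))
... | divides q refl =
  divides (q * q) (*-cancelˡ-≡ m (q * q * p) p {{prime⇒nonZero pp}} (trans pm≡R² (square q p)))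
  where
  square : ∀ q p → q * p * (q * p * 1) ≡ p * (q * q * p)
  square = solve-∀

∤-between : ∀ {p y} → p < y → y < 2 * p → p ∤ y
∤-between {p} p<y y<2p (divides q refl) with q ≤? 1
... | yes q≤1 = <⇒≱ p<y (≤-trans (*-monoˡ-≤ p q≤1) (≤-reflexive (*-identityˡ p)))
... | no q≰1 = <⇒≱ y<2p (*-monoˡ-≤ p (≰⇒> q≰1))

prime∤product : ∀ {p ms} → Prime p → All (p ∤_) ms → p ∤ product ms
prime∤product pp [] p∣1 = ¬prime[1] (subst Prime (∣1⇒≡1 p∣1) pp)
prime∤product {ms = m ∷ ms} pp (p∤m ∷ p∤ms) p∣m*ms with euclidsLemma m (product ms) pp p∣m*ms
... | inj₁ p∣m = p∤m p∣m
... | inj₂ p∣ms = prime∤product pp p∤ms p∣ms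

prime-completion⇒2p≤ : ∀ {p s} → Prime p → SquareCompletion p s → 2 * p ≤ s
prime-completion⇒2p≤ {p} {s} pp C = ≮⇒≥ λ s<2p →
  prime∤product pp (p∤factors s<2p) (prime*m-square⇒prime∣m {m = product factors} pp square)
  where
  open SquareCompletion C
  p∤factors : s < 2 * p → All (p ∤_) factors
  p∤factors s<2p = All.zipWith (λ (p<a , a≤s) → ∤-between p<a (≤-<-trans a≤s s<2p)) (above , atMost)

increasingLists : ℕ → ℕ → List (List ℕ)
increasingLists lo zero = [] ∷ []
increasingLists lo (suc k) = map (lo ∷_) (increasingLists (suc lo) k) ++ increasingLists (suc lo) k

[]∈increasingLists : ∀ lo k → [] ∈ increasingLists lo k
[]∈increasingLists lo zero = here refl
[]∈increasingLists lo (suc k) =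
  ∈-++⁺ʳ (map (lo ∷_) (increasingLists (suc lo) k)) ([]∈increasingLists (suc lo) k)

∈-increasingLists : ∀ {lo k xs} → Linked _<_ xs → All (lo ≤_) xs → All (_< lo + k) xs →
  xs ∈ increasingLists lo k
∈-increasingLists {lo} {k} {[]} _ _ _ = []∈increasingLists lo k
∈-increasingLists {lo} {zero} {x ∷ _} _ (lo≤x ∷ _) (x<lo+0 ∷ _) =
  contradiction (subst (x <_) (+-identityʳ lo) x<lo+0) (≤⇒≯ lo≤x)
∈-increasingLists {lo} {suc k} {x ∷ xs} x<xs (lo≤x ∷ _) x∷xs<hi
  with x ≟ lo | All.map (λ {y} → subst (y <_) (+-suc lo k)) x∷xs<hi
... | yes refl | _ ∷ xs<hi′ =
  ∈-++⁺ˡ (∈-map⁺ (x ∷_) (∈-increasingLists (Linked.tail x<xs) (head<all x<xs) xs<hi′))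
... | no x≢lo | x∷xs<hi′ = ∈-++⁺ʳ (map (lo ∷_) (increasingLists (suc lo) k))
  (∈-increasingLists x<xs (lo<x ∷ All.map (<-trans lo<x) (head<all x<xs)) x∷xs<hi′)
  where
  lo<x : lo < x
  lo<x = ≤∧≢⇒< lo≤x (x≢lo ∘ sym)

-- `noRootFrom c r fuel` is true only if no S ≥ r has S * S ≡ c; it succeeds as
-- soon as r * r exceeds c, so fuel suc c always suffices.
noRootFrom : ℕ → ℕ → ℕ → Bool
noRootFrom c r zero = false
noRootFrom c r (suc fuel) with c <? r * r
... | yes _ = true
... | no _ with r * r ≟ c
...   | yes _ = false
...   | no _ = noRootFrom c (suc r) fuel

noRootFrom-sound : ∀ c r fuel → T (noRootFrom c r fuel) → ∀ {S} → r ≤ S → S * S ≢ c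
noRootFrom-sound c r (suc fuel) ok r≤S S²≡c with c <? r * r
... | yes c<r² = <⇒≢ (<-≤-trans c<r² (*-mono-≤ r≤S r≤S)) (sym S²≡c)
... | no _ with r * r ≟ c
...   | yes _ = ⊥-elim ok
...   | no r²≢c with m≤n⇒m<n∨m≡n r≤S
...     | inj₁ r<S = noRootFrom-sound c (suc r) fuel ok r<S S²≡c
...     | inj₂ refl = r²≢c S²≡c

nonSquare : ℕ → Bool
nonSquare c = noRootFrom c 0 (suc c)

nonSquare-sound : ∀ {c} → T (nonSquare c) → ¬ IsSquare c
nonSquare-sound {c} ok (R , c≡R²) =
  noRootFrom-sound c 0 (suc c) ok {R} z≤n (trans (cong (R *_) (sym (*-identityʳ R))) (sym c≡R²))

no-completion-below : ∀ n k {s} →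
  All (T ∘ nonSquare ∘ (n *_) ∘ product) (increasingLists (suc n) k) →
  SquareCompletion n s → suc n + k ≤ s
no-completion-below n k nonSquares C = ≮⇒≥ λ s<bound →
  nonSquare-sound (All.lookup nonSquares (∈-increasingLists increasing above
    (All.map (λ a≤s → ≤-<-trans a≤s s<bound) atMost))) square
  where open SquareCompletion C

nonSquareProducts? : ∀ n k → Dec (All (T ∘ nonSquare ∘ (n *_) ∘ product) (increasingLists (suc n) k))
nonSquareProducts? n k = All.all? (T? ∘ nonSquare ∘ (n *_) ∘ product) (increasingLists (suc n) k)

reaches-square : ∀ q → Reaches 2 (q * q) (q * q)
reaches-square q = increasing⇒reaches ≤-refl [-] (q , *-assoc q q 1) refl

reaches-succ-product : ∀ {a b} → 0 < a → a < b → Reaches 2 (a * b) (suc a * suc b)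
reaches-succ-product {a@(suc _)} {b} _ a<b =
  increasing⇒reaches ≤-refl (ab<ab′ ∷ ab′<a′b ∷ a′b<a′b′ ∷ [-])
    (a * b * suc a * suc b , square a b) refl
  where
  ab<ab′ : a * b < a * suc b
  ab<ab′ = *-monoʳ-< a (n<1+n b)
  ab′<a′b : a * suc b < suc a * b
  ab′<a′b = subst (_< b + a * b) (sym (*-suc a b)) (+-monoˡ-< (a * b) a<b)
  a′b<a′b′ : suc a * b < suc a * suc b
  a′b<a′b′ = *-monoʳ-< (suc a) (n<1+n b)
  square : ∀ a b → a * b * (a * (1 + b) * ((1 + a) * b * ((1 + a) * (1 + b) * 1)))
                  ≡ a * b * (1 + a) * (1 + b) * (a * b * (1 + a) * (1 + b) * 1)
  square = solve-∀

-- With a = 2 + i and b = 3 + i + j, the excess 2ab − (a + 1)(b + 1) vanishes only at i = j = 0.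
succ-product<double : ∀ {a b} → 2 ≤ a → a < b → a * b ≢ 6 → suc a * suc b < 2 * (a * b)
succ-product<double {suc (suc i)} (s≤s (s≤s z≤n)) a<b ab≢6 with ≤⇒≤″ a<b
... | j , refl = subst ((3 + i) * (4 + i + j) <_) (sym (double i j)) (m<m+n _ (excess>0 i j ab≢6))
  where
  double : ∀ i j → 2 * ((2 + i) * (3 + i + j)) ≡ (3 + i) * (4 + i + j) + (3 * i + j + i * i + i * j)
  double = solve-∀
  excess>0 : ∀ i j → (2 + i) * (3 + i + j) ≢ 6 → 0 < 3 * i + j + i * i + i * j
  excess>0 zero zero ab≢6 = contradiction refl ab≢6
  excess>0 zero (suc _) _ = z<s
  excess>0 (suc _) _ _ = z<s

between-squares : ∀ {m} → 0 < m → ∃ λ k → k * k < m × m ≤ suc k * suc k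
between-squares {suc zero} _ = 0 , z<s , s≤s z≤n
between-squares {suc (suc m)} _ with between-squares {suc m} z<s
... | k , k²<m , m≤k′² with m≤n⇒m<n∨m≡n m≤k′²
...   | inj₁ m<k′² = k , m<n⇒m<1+n k²<m , m<k′²
...   | inj₂ m≡k′² = suc k , subst (_< suc (suc m)) m≡k′² (n<1+n _) ,
          subst (_< suc (suc k) * suc (suc k)) (sym m≡k′²) (*-mono-< (n<1+n (suc k)) (n<1+n (suc k)))

succ-square<double-square : ∀ {k} → 3 ≤ k → suc k * suc k < 2 * (k * k)
succ-square<double-square {suc (suc (suc t))} (s≤s (s≤s (s≤s z≤n))) =
  subst ((4 + t) * (4 + t) <_) (double t) (m<m+n _ z<s)
  where
  double : ∀ t → (4 + t) * (4 + t) + (2 + 4 * t + t * t) ≡ 2 * ((3 + t) * (3 + t))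
  double = solve-∀

-- For k ≤ 2 the bracket k² < p ≤ (k + 1)² leaves only p ∈ {4, 8, 9} to exclude.
prime<double-square : ∀ {p k} → 3 < p → Prime p → k * k < p → p ≤ suc k * suc k → p < 2 * (k * k)
prime<double-square {k = zero} 3<p _ _ p≤1 = contradiction (≤-trans 3<p p≤1) (<⇒≱ (s≤s (s≤s z≤n)))
prime<double-square {k = suc zero} 3<p pp _ p≤4 =
  contradiction (subst Prime (≤-antisym p≤4 3<p) pp) (from-no (prime? 4))
prime<double-square {p} {suc (suc zero)} _ pp _ p≤9 with <-cmp p 8
... | tri< p<8 _ _ = p<8
... | tri≈ _ refl _ = contradiction pp (from-no (prime? 8))
... | tri> _ _ 8<p = contradiction (subst Prime (≤-antisym p≤9 8<p) pp) (from-no (prime? 9))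
prime<double-square {k = suc (suc (suc _))} _ _ _ p≤k′² =
  ≤-<-trans p≤k′² (succ-square<double-square (s≤s (s≤s (s≤s z≤n))))

prime-reaches-double : ∀ {p} → 3 < p → Prime p → Reaches 2 p (2 * p)
prime-reaches-double {p} 3<p pp with between-squares (≤-trans (s≤s z≤n) 3<p)
... | k , k²<p , p≤k′² =
  increasing⇒reaches ≤-refl (prime<double-square {k = k} 3<p pp k²<p p≤k′² ∷ *-monoʳ-< 2 k²<p ∷ [-])
    (2 * p * k , square p k) refl
  where
  square : ∀ p k → p * (2 * (k * k) * (2 * p * 1)) ≡ 2 * p * k * (2 * p * k * 1)
  square = solve-∀

composite⇒square⊎distinctFactors : ∀ {n} → Composite n →
  (∃ λ q → n ≡ q * q) ⊎ (∃₂ λ a b → 2 ≤ a × a < b × n ≡ a * b)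
composite⇒square⊎distinctFactors (composite {d} d<n (divides q n≡qd)) with <-cmp d q
... | tri< d<q _ _ = inj₂ (d , q , nonTrivial⇒n>1 d , d<q , trans n≡qd (*-comm q d))
... | tri≈ _ refl _ = inj₁ (d , n≡qd)
... | tri> _ _ q<d = inj₂ (q , d , 1<q , q<d , n≡qd)
  where
  1<q : 1 < q
  1<q = ≰⇒> λ q≤1 → <⇒≱ d<n (≤-trans (≤-reflexive n≡qd)
    (≤-trans (*-monoˡ-≤ d q≤1) (≤-reflexive (*-identityˡ d))))

n<2*n : ∀ {n} → .{{NonZero n}} → n < 2 * n
n<2*n {n} = subst (n <_) (*-comm n 2) (m<m*n n 2 ≤-refl)

composite≢6⇒reaches-below-double : ∀ {n} → Composite n → n ≢ 6 → ∃ λ s → s < 2 * n × Reaches 2 n s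
composite≢6⇒reaches-below-double c n≢6 with composite⇒square⊎distinctFactors c
... | inj₁ (q , refl) = q * q , n<2*n {{composite⇒nonZero c}} , reaches-square q
... | inj₂ (a , b , 2≤a , a<b , refl) =
  suc a * suc b , succ-product<double 2≤a a<b n≢6 , reaches-succ-product (<-trans z<s 2≤a) a<b

double⇒classified : ∀ n → IsG 2 n (2 * n) → (3 < n × Prime n) ⊎ (n ≡ 0 ⊎ n ≡ 6)
double⇒classified 0 _ = inj₂ (inj₁ refl)
double⇒classified 1 G = contradiction G (reaches-below⇒¬IsG (reaches-square 1) ≤-refl)
double⇒classified 2 G = contradiction
  (no-completion-below 2 2 (from-yes (nonSquareProducts? 2 2)) (reaches⇒completion (proj₁ G))) (<-irrefl refl)
double⇒classified 3 G = contradiction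
  (no-completion-below 3 3 (from-yes (nonSquareProducts? 3 3)) (reaches⇒completion (proj₁ G))) (<-irrefl refl)
double⇒classified n@(suc (suc (suc (suc m)))) G with prime? n | n ≟ 6
... | yes pn | _ = inj₁ (m≤m+n 4 m , pn)
... | no _ | yes n≡6 = inj₂ (inj₂ n≡6)
... | no ¬pn | no n≢6 with composite≢6⇒reaches-below-double (¬prime⇒composite ¬pn) n≢6
...   | s , s<2n , r = contradiction G (reaches-below⇒¬IsG r s<2n)

classified⇒double : ∀ n → (3 < n × Prime n) ⊎ (n ≡ 0 ⊎ n ≡ 6) → IsG 2 n (2 * n)
classified⇒double p (inj₁ (3<p , pp)) =
  prime-reaches-double 3<p pp , λ _ r → prime-completion⇒2p≤ pp (reaches⇒completion r)
classified⇒double .0 (inj₂ (inj₁ refl)) = increasing⇒reaches ≤-refl [-] (0 , refl) refl , λ _ _ → z≤n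
classified⇒double .6 (inj₂ (inj₂ refl)) =
  increasing⇒reaches {as = 8 ∷ 9 ∷ 12 ∷ []} ≤-refl
    (from-yes (Linked.linked? _<?_ (6 ∷ 8 ∷ 9 ∷ 12 ∷ []))) (72 , refl) refl ,
  λ _ r → no-completion-below 6 5 (from-yes (nonSquareProducts? 6 5)) (reaches⇒completion r)

theorem3p4 : ∀ (n : ℕ) → IsG 2 n (2 * n) ⇔ ((3 < n × Prime n) ⊎ (n ≡ 0 ⊎ n ≡ 6))
theorem3p4 n = mk⇔ (double⇒classified n) (classified⇒double n)
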